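{- There is an absolute constant $c>0$ such that every valid move sequence $W$ satisfies $\mathrm{rank}_{\mathrm{arcs}}(W)\ge c\,|V_2(W)|$.
   Context: $V_n=[n]$, $K_n=(V_n,E_n)$ complete graph. A move sequence is $W=(W_1,\dots,W_L)$ with each $W_i\subseteq V_n$ of size 1 (1-move) or 2; $V(W)$ is its set of nodes and $E(W)$ the edges with both endpoints in $V(W)$. $W$ is valid if for all $i<j\le L$ some node $w\notin W_i$ belongs to an odd number of $W_i,\dots,W_j$. $V_2(W)$ is the set of nodes $u$ such that at least two 1-moves of $W$ equal $\{u\}$. For $\tau_0\in\{\pm1\}^{V(W)}$, $\tau_i$ is obtained from $\tau_{i-1}$ by flipping the nodes of $W_i$. $\mathrm{imprv}_{\tau_0,W}(i)\in\{0,\pm1\}^{E(W)}$: if $W_i=\{u\}$, its entry at $\{u,w\}$ is $\tau_{i-1}(u)\tau_{i-1}(w)$, other entries 0; if $W_i=\{u,v\}$, entry at $\{u,w\}$ ($w\notin\{u,v\}$) is $\tau_{i-1}(u)\tau_{i-1}(w)$, at $\{v,w\}$ ($w\notin\{u,v\}$) is $\tau_{i-1}(v)\tau_{i-1}(w)$, others 0. An arc is a pair $\alpha=(i,j)$, $i<j$, with $W_i=W_j=\{u\}$ and $W_k\neq\{u\}$ for $i<k<j$; its vector is $\tau_i(u)\mathrm{imprv}_{\tau_0,W}(i)-\tau_j(u)\mathrm{imprv}_{\tau_0,W}(j)$. $\mathrm{rank}_{\mathrm{arcs}}(W)$ is the rank of the set of vectors of all arcs of $W$ (independent of $\tau_0$).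 -}

module Defs where

open import Data.Nat as ℕ using (ℕ; zero; suc)
open import Data.Integer using (+_)
open import Data.Rational using (ℚ; 0ℚ; 1ℚ; -_; _+_; _*_; _-_; _/_)
open import Data.Fin as Fin using (Fin; toℕ)
open import Data.Fin.Properties using () renaming (_≟_ to _≟ᶠ_)
open import Data.Bool using (Bool; true; false; not; if_then_else_; _∨_; _xor_)
open import Data.List as List using (List; []; _∷_; length; lookup; take; drop; filter; allFin; foldl)
open import Data.Product using (Σ; _×_; _,_; ∃)
open import Relation.Nullary using (¬_; Dec; yes; no)
open import Relation.Nullary.Decidable using (⌊_⌋)
open import Relation.Binary.PropositionalEquality using (_≡_; _≢_)

data Move (n : ℕ) : Set where
  one : Fin n → Move n
  two : (u v : Fin n) → u ≢ v → Move n

MoveSeq : ℕ → Set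
MoveSeq n = List (Move n)

_∈ᵐ_ : {n : ℕ} → Fin n → Move n → Bool
x ∈ᵐ one u = ⌊ x ≟ᶠ u ⌋
x ∈ᵐ two u v _ = ⌊ x ≟ᶠ u ⌋ ∨ ⌊ x ≟ᶠ v ⌋

isOne : {n : ℕ} → Fin n → Move n → Bool
isOne x (one u) = ⌊ x ≟ᶠ u ⌋
isOne x (two _ _ _) = false

countIn : {n : ℕ} → Fin n → MoveSeq n → ℕ
countIn x [] = 0
countIn x (m ∷ W) = (if x ∈ᵐ m then 1 else 0) ℕ.+ countIn x W

countOne : {n : ℕ} → Fin n → MoveSeq n → ℕ
countOne x [] = 0
countOne x (m ∷ W) = (if isOne x m then 1 else 0) ℕ.+ countOne x W

inV : {n : ℕ} → MoveSeq n → Fin n → Bool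
inV [] x = false
inV (m ∷ W) x = (x ∈ᵐ m) ∨ inV W x

Odd : ℕ → Set
Odd k = ℕ._%_ k 2 ≡ 1

-- Validity. Moves are indexed 0-based: position k ↔ W_{k+1}.
-- For all k < l < L, some node w ∉ W_k lies in an odd number of W_k, …, W_l.
Valid : {n : ℕ} → MoveSeq n → Set
Valid {n} W = (k l : Fin (length W)) → k Fin.< l →
  ∃ λ (w : Fin n) → (w ∈ᵐ lookup W k ≡ false) ×
    Odd (countIn w (take (suc (toℕ l) ℕ.∸ toℕ k) (drop (toℕ k) W)))

V2size : {n : ℕ} → MoveSeq n → ℕ
V2size {n} W = length (filter (λ u → 2 ℕ.≤? countOne u W) (allFin n))

Config : ℕ → Set
Config n = Fin n → Bool

sgn : Bool → ℚ
sgn true = 1ℚ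
sgn false = - 1ℚ

flip : {n : ℕ} → Config n → Move n → Config n
flip τ m x = if x ∈ᵐ m then not (τ x) else τ x

run : {n : ℕ} → Config n → MoveSeq n → Config n
run τ W = foldl flip τ W

τAt : {n : ℕ} → Config n → MoveSeq n → ℕ → Config n
τAt τ₀ W k = run τ₀ (take k W)

-- Vectors indexed by edges of K_n, represented as functions on ordered
-- pairs (a,b); the entry for the edge {a,b} is the value at (a,b) (= at (b,a)).
EdgeVec : ℕ → Set
EdgeVec n = Fin n → Fin n → ℚ

zeroV : {n : ℕ} → EdgeVec n
zeroV _ _ = 0ℚ

half : {n : ℕ} → MoveSeq n → Config n → Move n → Fin n → Fin n → Fin n → ℚ
half W τ m u a b with a ≟ᶠ u
... | no _ = 0ℚ
... | yes _ = if inV W b ∧' not (b ∈ᵐ m) then sgn (τ u) * sgn (τ b) else 0ℚ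
  where
  _∧'_ : Bool → Bool → Bool
  true ∧' y = y
  false ∧' _ = false

-- imprv for move m performed in configuration τ (= τ_{i-1}), restricted to
-- edges of E(W) (entries outside E(W) are 0).
imprv : {n : ℕ} → MoveSeq n → Config n → Move n → EdgeVec n
imprv W τ (one u) a b = half W τ (one u) u a b + half W τ (one u) u b a
imprv W τ (two u v p) a b =
  (half W τ (two u v p) u a b + half W τ (two u v p) u b a) +
  (half W τ (two u v p) v a b + half W τ (two u v p) v b a)

record Arc {n : ℕ} (W : MoveSeq n) : Set where
  field
    i j : Fin (length W)
    i<j : i Fin.< j
    u : Fin n
    Wi : lookup W i ≡ one u
    Wj : lookup W j ≡ one u
    between : (k : Fin (length W)) → i Fin.< k → k Fin.< j → lookup W k ≢ one u

-- arc vector  τ_i(u) imprv(i) − τ_j(u) imprv(j)  (paper's 1-based indices)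
arcVec : {n : ℕ} → Config n → (W : MoveSeq n) → Arc W → EdgeVec n
arcVec τ₀ W α a b =
  sgn (τAt τ₀ W (suc (toℕ i)) u) * imprv W (τAt τ₀ W (toℕ i)) (lookup W i) a b
  - sgn (τAt τ₀ W (suc (toℕ j)) u) * imprv W (τAt τ₀ W (toℕ j)) (lookup W j) a b
  where open Arc α

sumFin : (k : ℕ) → (Fin k → ℚ) → ℚ
sumFin zero f = 0ℚ
sumFin (suc k) f = f Fin.zero + sumFin k (λ t → f (Fin.suc t))

LinIndep : {n k : ℕ} → (Fin k → EdgeVec n) → Set
LinIndep {n} {k} v = (λs : Fin k → ℚ) →
  ((a b : Fin n) → sumFin k (λ t → λs t * v t a b) ≡ 0ℚ) →
  (t : Fin k) → λs t ≡ 0ℚ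

-- rank_arcs(W) ≥ r : some r arcs have linearly independent vectors
-- (rank = maximal size of a linearly independent subset of the arc vectors)
RankArcsAtLeast : {n : ℕ} → Config n → MoveSeq n → ℕ → Set
RankArcsAtLeast τ₀ W r =
  Σ (Fin r → Arc W) λ arcs → LinIndep (λ t → arcVec τ₀ W (arcs t))

ℕtoℚ : ℕ → ℚ
ℕtoℚ m = + m / 1

-- For u ∈ V₂(W) let (i,j) be the arc formed by the first two 1-moves {u}. Validity on W_i, …, W_j
-- gives a node w ∉ {u} moved an odd number of times there, so τ(w) has opposite signs at i and j and
-- the arc vector is nonzero on the edge {u,w}, while it vanishes on every edge avoiding u. Orient each
-- such pair by comparing u and w: one orientation is shared by at least half of V₂(W), and on that half
-- the vectors are triangular with respect to the order of their centres, hence independent. So c = 1/2.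
module Submission where

open import Defs
open import Data.Nat using (ℕ)
open import Data.Rational using (ℚ; 0ℚ; _*_; _<_; _≤_)
open import Data.Product using (Σ; _×_; ∃)

open import Data.Bool using (Bool; true; false; not; _∨_; _xor_)
open import Data.Bool.Properties
  using (not-involutive; xor-identityʳ; xor-comm; not-distribˡ-xor; not-distribʳ-xor; ∨-zeroʳ)
open import Data.Empty using (⊥-elim)
open import Data.Fin as Fin using (Fin; toℕ)
open import Data.Fin.Properties using () renaming (_≟_ to _≟ᶠ_)
import Data.Fin.Properties as Finₚ
import Data.Integer as ℤ
import Data.Integer.Properties as ℤₚ
open import Data.List using (List; []; _∷_; length; lookup; take; drop; filter; allFin; map)
open import Data.List.Properties using (take-suc; take-[]; foldl-∷ʳ; length-map)
open import Data.List.Membership.Propositional.Properties using (∈-lookup)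
open import Data.List.Relation.Unary.All as All using (All; []; _∷_)
open import Data.List.Relation.Unary.All.Properties using (all-filter)
open import Data.List.Relation.Unary.AllPairs using (AllPairs; []; _∷_)
import Data.List.Relation.Unary.AllPairs.Properties as AllPairs
open import Data.List.Relation.Unary.Unique.Propositional using (Unique)
open import Data.List.Relation.Unary.Unique.Propositional.Properties
  using (allFin⁺) renaming (filter⁺ to Unique-filter⁺)
import Data.Nat as Nat
open Nat using (zero; suc; z≤n; s≤s)
import Data.Nat.Coprimality as Coprime
import Data.Nat.Properties as Natₚ
open import Data.Product using (_,_; proj₁; proj₂)
open import Data.Rational using (mkℚ; 1ℚ; -_; _-_; _+_; ½; 1/_; NonZero; ≢-nonZero)
import Data.Rational.Properties as ℚₚ
import Data.Rational.Unnormalised as ℚᵘ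
import Data.Rational.Unnormalised.Properties as ℚᵘ
open import Data.Sum using (inj₁; inj₂)
open import Function using (_∘_)
open import Relation.Binary.PropositionalEquality
open import Relation.Nullary using (Dec; yes; no; ¬?)
open import Relation.Unary using (Decidable)

isOdd : ℕ → Bool
isOdd zero = false
isOdd (suc k) = not (isOdd k)

Odd⇒isOdd : ∀ k → Odd k → isOdd k ≡ true
Odd⇒isOdd zero ()
Odd⇒isOdd (suc zero) _ = refl
Odd⇒isOdd (suc (suc k)) odd = trans (not-involutive (isOdd k)) (Odd⇒isOdd k odd)

module _ {n : ℕ} where

  ∈ᵐ-one-self : (u : Fin n) → u ∈ᵐ one u ≡ true
  ∈ᵐ-one-self u with u ≟ᶠ u
  ... | yes _ = refl
  ... | no u≢u = ⊥-elim (u≢u refl)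

  ∉ᵐ-one : {w u : Fin n} → w ≢ u → w ∈ᵐ one u ≡ false
  ∉ᵐ-one {w} {u} w≢u with w ≟ᶠ u
  ... | yes w≡u = ⊥-elim (w≢u w≡u)
  ... | no _ = refl

  ∉ᵐ-one⇒≢ : {w u : Fin n} → w ∈ᵐ one u ≡ false → w ≢ u
  ∉ᵐ-one⇒≢ {u = u} w∉ refl with trans (sym w∉) (∈ᵐ-one-self u)
  ... | ()

  flip-∈ : (τ : Config n) (m : Move n) (x : Fin n) → x ∈ᵐ m ≡ true → flip τ m x ≡ not (τ x)
  flip-∈ τ m x x∈m rewrite x∈m = refl

  flip-∉ : (τ : Config n) (m : Move n) (x : Fin n) → x ∈ᵐ m ≡ false → flip τ m x ≡ τ x
  flip-∉ τ m x x∉m rewrite x∉m = refl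

  run-flips : (τ : Config n) (X : MoveSeq n) (w : Fin n) →
    run τ X w ≡ τ w xor isOdd (countIn w X)
  run-flips τ [] w = sym (xor-identityʳ (τ w))
  run-flips τ (m ∷ X) w with run-flips (flip τ m) X w
  ... | ih with w ∈ᵐ m
  ... | true = trans ih (trans (sym (not-distribˡ-xor (τ w) _)) (not-distribʳ-xor (τ w) _))
  ... | false = ih

  τAt-suc : (τ₀ : Config n) (W : MoveSeq n) (k : Fin (length W)) →
    τAt τ₀ W (suc (toℕ k)) ≡ flip (τAt τ₀ W (toℕ k)) (lookup W k)
  τAt-suc τ₀ W k = trans (cong (run τ₀) (take-suc W k)) (foldl-∷ʳ flip τ₀ (lookup W k) (take (toℕ k) W))

  τAt-+ : (τ₀ : Config n) (W : MoveSeq n) (m k : ℕ) →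
    τAt τ₀ W (m Nat.+ k) ≡ run (τAt τ₀ W m) (take k (drop m W))
  τAt-+ τ₀ W zero k = refl
  τAt-+ τ₀ [] (suc m) k = cong (run τ₀) (sym (take-[] k))
  τAt-+ τ₀ (x ∷ W) (suc m) k = τAt-+ (flip τ₀ x) W m k

  τAt-parity : (τ₀ : Config n) (W : MoveSeq n) {m m′ : ℕ} → m Nat.≤ m′ → (w : Fin n) →
    τAt τ₀ W m′ w ≡ τAt τ₀ W m w xor isOdd (countIn w (take (m′ Nat.∸ m) (drop m W)))
  τAt-parity τ₀ W {m} {m′} m≤m′ w = begin
    τAt τ₀ W m′ w
      ≡⟨ cong (λ k → τAt τ₀ W k w) (sym (Natₚ.m+[n∸m]≡n m≤m′)) ⟩
    τAt τ₀ W (m Nat.+ (m′ Nat.∸ m)) w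
      ≡⟨ cong-app (τAt-+ τ₀ W m (m′ Nat.∸ m)) w ⟩
    run (τAt τ₀ W m) (take (m′ Nat.∸ m) (drop m W)) w
      ≡⟨ run-flips (τAt τ₀ W m) (take (m′ Nat.∸ m) (drop m W)) w ⟩
    τAt τ₀ W m w xor isOdd (countIn w (take (m′ Nat.∸ m) (drop m W))) ∎
    where open ≡-Reasoning

  inV-odd : {X : MoveSeq n} {w : Fin n} → isOdd (countIn w X) ≡ true → inV X w ≡ true
  inV-odd {[]} ()
  inV-odd {m ∷ X} {w} odd with w ∈ᵐ m
  ... | true = refl
  ... | false = inV-odd {X} odd

  inV-take : ∀ k (X : MoveSeq n) {w} → inV (take k X) w ≡ true → inV X w ≡ true
  inV-take (suc k) (m ∷ X) {w} w∈ with w ∈ᵐ m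
  ... | true = refl
  ... | false = inV-take k X w∈

  inV-drop : ∀ k (X : MoveSeq n) {w} → inV (drop k X) w ≡ true → inV X w ≡ true
  inV-drop zero X w∈ = w∈
  inV-drop (suc k) (m ∷ X) {w} w∈ = trans (cong (w ∈ᵐ m ∨_) (inV-drop k X w∈)) (∨-zeroʳ _)

  record FirstOccurrence (u : Fin n) (W : MoveSeq n) : Set where
    field
      pos : Fin (length W)
      at : lookup W pos ≡ one u
      before : ∀ k → k Fin.< pos → lookup W k ≢ one u

  firstOccurrence-∷ : {u : Fin n} {W : MoveSeq n} (m : Move n) → m ≢ one u →
    FirstOccurrence u W → FirstOccurrence u (m ∷ W)
  firstOccurrence-∷ m m≢u occ = record
    { pos = Fin.suc pos
    ; at = at
    ; before = λ { Fin.zero _ → m≢u ; (Fin.suc k) (s≤s k<pos) → before k k<pos }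
    }
    where open FirstOccurrence occ

  firstOccurrence : (u : Fin n) (W : MoveSeq n) → 1 Nat.≤ countOne u W → FirstOccurrence u W
  firstOccurrence u (one x ∷ W) p with u ≟ᶠ x
  ... | yes refl = record { pos = Fin.zero ; at = refl ; before = λ _ () }
  ... | no u≢x = firstOccurrence-∷ (one x) (λ { refl → u≢x refl }) (firstOccurrence u W p)
  firstOccurrence u (two a b a≢b ∷ W) p = firstOccurrence-∷ (two a b a≢b) (λ ()) (firstOccurrence u W p)

  Arc-∷ : {W : MoveSeq n} (m : Move n) → Arc W → Arc (m ∷ W)
  Arc-∷ m α = record
    { i = Fin.suc i ; j = Fin.suc j ; i<j = s≤s i<j ; u = u ; Wi = Wi ; Wj = Wj
    ; between = λ { Fin.zero () _ ; (Fin.suc k) (s≤s i<k) (s≤s k<j) → between k i<k k<j }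
    }
    where open Arc α

  firstArc : (u : Fin n) (W : MoveSeq n) → 2 Nat.≤ countOne u W → Σ (Arc W) λ α → Arc.u α ≡ u
  firstArc u (one x ∷ W) p with u ≟ᶠ x
  firstArc u (one u ∷ W) (s≤s p) | yes refl = record
    { i = Fin.zero ; j = Fin.suc pos ; i<j = s≤s z≤n ; u = u ; Wi = refl ; Wj = at
    ; between = λ { Fin.zero () _ ; (Fin.suc k) _ (s≤s k<pos) → before k k<pos }
    } , refl
    where open FirstOccurrence (firstOccurrence u W p)
  ... | no _ = let α , α-at-u = firstArc u W p in Arc-∷ (one x) α , α-at-u
  firstArc u (two a b a≢b ∷ W) p = let α , α-at-u = firstArc u W p in Arc-∷ (two a b a≢b) α , α-at-u

  half-off : (W : MoveSeq n) (τ : Config n) (m : Move n) {u a : Fin n} (b : Fin n) →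
    a ≢ u → half W τ m u a b ≡ 0ℚ
  half-off W τ m {u} {a} b a≢u with a ≟ᶠ u
  ... | yes a≡u = ⊥-elim (a≢u a≡u)
  ... | no _ = refl

  imprv-one-off-star : (W : MoveSeq n) (τ : Config n) {u a b : Fin n} → a ≢ u → b ≢ u →
    imprv W τ (one u) a b ≡ 0ℚ
  imprv-one-off-star W τ {u} {a} {b} a≢u b≢u
    rewrite half-off W τ (one u) b a≢u | half-off W τ (one u) a b≢u = refl

  imprv-one-centre : (W : MoveSeq n) (τ : Config n) {u w : Fin n} → w ≢ u → inV W w ≡ true →
    imprv W τ (one u) u w ≡ sgn (τ u) * sgn (τ w) + 0ℚ
  imprv-one-centre W τ {u} {w} w≢u w∈V rewrite half-off W τ (one u) u w≢u with u ≟ᶠ u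
  ... | no u≢u = ⊥-elim (u≢u refl)
  ... | yes _ rewrite w∈V | ∉ᵐ-one w≢u = refl

sgn-not-* : ∀ x z → sgn (not x) * (sgn x * sgn z + 0ℚ) ≡ - sgn z
sgn-not-* true true = refl
sgn-not-* true false = refl
sgn-not-* false true = refl
sgn-not-* false false = refl

-sgn-opposite-difference≢0 : ∀ z → - sgn z - - sgn (not z) ≢ 0ℚ
-sgn-opposite-difference≢0 true ()
-sgn-opposite-difference≢0 false ()

module _ {n : ℕ} (τ₀ : Config n) (W : MoveSeq n) where

  τ : ℕ → Config n
  τ = τAt τ₀ W

  τ-suc-centre : {k : Fin (length W)} {u : Fin n} → lookup W k ≡ one u →
    τ (suc (toℕ k)) u ≡ not (τ (toℕ k) u)
  τ-suc-centre {k} {u} Wk = trans (cong-app (τAt-suc τ₀ W k) u)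
    (trans (cong (λ m → flip (τ (toℕ k)) m u) Wk) (flip-∈ (τ (toℕ k)) (one u) u (∈ᵐ-one-self u)))

  τ-suc-other : {k : Fin (length W)} {u x : Fin n} → lookup W k ≡ one u → x ≢ u →
    τ (suc (toℕ k)) x ≡ τ (toℕ k) x
  τ-suc-other {k} {u} {x} Wk x≢u = trans (cong-app (τAt-suc τ₀ W k) x)
    (trans (cong (λ m → flip (τ (toℕ k)) m x) Wk) (flip-∉ (τ (toℕ k)) (one u) x (∉ᵐ-one x≢u)))

  -- τ_{k+1}(u) imprv(k) in the paper's notation: arcVec τ₀ W α unfolds to endTerm u i - endTerm u j.
  endTerm : Fin n → Fin (length W) → EdgeVec n
  endTerm u k a b = sgn (τ (suc (toℕ k)) u) * imprv W (τ (toℕ k)) (lookup W k) a b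

  endTerm-off-star : {k : Fin (length W)} {u a b : Fin n} → lookup W k ≡ one u → a ≢ u → b ≢ u →
    endTerm u k a b ≡ 0ℚ
  endTerm-off-star {k} {u} {a} {b} Wk a≢u b≢u = begin
    sgn (τ (suc (toℕ k)) u) * imprv W (τ (toℕ k)) (lookup W k) a b
      ≡⟨ cong (λ m → sgn (τ (suc (toℕ k)) u) * imprv W (τ (toℕ k)) m a b) Wk ⟩
    sgn (τ (suc (toℕ k)) u) * imprv W (τ (toℕ k)) (one u) a b
      ≡⟨ cong (sgn (τ (suc (toℕ k)) u) *_) (imprv-one-off-star W (τ (toℕ k)) a≢u b≢u) ⟩
    sgn (τ (suc (toℕ k)) u) * 0ℚ
      ≡⟨ ℚₚ.*-zeroʳ (sgn (τ (suc (toℕ k)) u)) ⟩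
    0ℚ ∎
    where open ≡-Reasoning

  endTerm-centre : {k : Fin (length W)} {u w : Fin n} → lookup W k ≡ one u → w ≢ u → inV W w ≡ true →
    endTerm u k u w ≡ - sgn (τ (toℕ k) w)
  endTerm-centre {k} {u} {w} Wk w≢u w∈V = begin
    sgn (τ (suc (toℕ k)) u) * imprv W (τ (toℕ k)) (lookup W k) u w
      ≡⟨ cong₂ (λ s m → sgn s * imprv W (τ (toℕ k)) m u w) (τ-suc-centre Wk) Wk ⟩
    sgn (not (τ (toℕ k) u)) * imprv W (τ (toℕ k)) (one u) u w
      ≡⟨ cong (sgn (not (τ (toℕ k) u)) *_) (imprv-one-centre W (τ (toℕ k)) w≢u w∈V) ⟩
    sgn (not (τ (toℕ k) u)) * (sgn (τ (toℕ k) u) * sgn (τ (toℕ k) w) + 0ℚ)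
      ≡⟨ sgn-not-* (τ (toℕ k) u) (τ (toℕ k) w) ⟩
    - sgn (τ (toℕ k) w) ∎
    where open ≡-Reasoning

  record StarArc (u : Fin n) : Set where
    field
      arc : Arc W
      partner : Fin n
      partner≢centre : partner ≢ u
      arcVec-partner≢0 : arcVec τ₀ W arc u partner ≢ 0ℚ
      arcVec-off-star : ∀ a b → a ≢ u → b ≢ u → arcVec τ₀ W arc a b ≡ 0ℚ

  -- Validity at the endpoints of α yields a node w ∉ W_i moved an odd number of times along the arc;
  -- both endpoint terms at {u,w} equal -τ(w), and τ(w) has changed sign in between.
  Arc⇒StarArc : Valid W → (α : Arc W) → StarArc (Arc.u α)
  Arc⇒StarArc valid α = record
    { arc = α
    ; partner = w
    ; partner≢centre = w≢u
    ; arcVec-partner≢0 = λ vanishes → -sgn-opposite-difference≢0 (τ (toℕ i) w) (trans (sym entry) vanishes)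
    ; arcVec-off-star = λ a b a≢u b≢u →
        trans (cong₂ _-_ (endTerm-off-star Wi a≢u b≢u) (endTerm-off-star Wj a≢u b≢u)) (ℚₚ.+-inverseʳ 0ℚ)
    }
    where
    open Arc α
    open ≡-Reasoning
    segment : MoveSeq n
    segment = take (suc (toℕ j) Nat.∸ toℕ i) (drop (toℕ i) W)
    w : Fin n
    w = proj₁ (valid i j i<j)
    w≢u : w ≢ u
    w≢u = ∉ᵐ-one⇒≢ (subst (λ m → w ∈ᵐ m ≡ false) Wi (proj₁ (proj₂ (valid i j i<j))))
    segment-odd : isOdd (countIn w segment) ≡ true
    segment-odd = Odd⇒isOdd (countIn w segment) (proj₂ (proj₂ (valid i j i<j)))
    w∈V : inV W w ≡ true
    w∈V = inV-drop (toℕ i) W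
            (inV-take (suc (toℕ j) Nat.∸ toℕ i) (drop (toℕ i) W) (inV-odd {X = segment} segment-odd))
    w-flipped : τ (toℕ j) w ≡ not (τ (toℕ i) w)
    w-flipped = begin
      τ (toℕ j) w                                 ≡⟨ sym (τ-suc-other Wj w≢u) ⟩
      τ (suc (toℕ j)) w                           ≡⟨ τAt-parity τ₀ W (Natₚ.m≤n⇒m≤1+n (Natₚ.<⇒≤ i<j)) w ⟩
      τ (toℕ i) w xor isOdd (countIn w segment)   ≡⟨ cong (τ (toℕ i) w xor_) segment-odd ⟩
      τ (toℕ i) w xor true                        ≡⟨ xor-comm (τ (toℕ i) w) true ⟩
      not (τ (toℕ i) w)                           ∎
    entry : arcVec τ₀ W α u w ≡ - sgn (τ (toℕ i) w) - - sgn (not (τ (toℕ i) w))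
    entry = begin
      endTerm u i u w - endTerm u j u w
        ≡⟨ cong₂ _-_ (endTerm-centre Wi w≢u w∈V) (endTerm-centre Wj w≢u w∈V) ⟩
      - sgn (τ (toℕ i) w) - - sgn (τ (toℕ j) w)
        ≡⟨ cong (λ s → - sgn (τ (toℕ i) w) - - sgn s) w-flipped ⟩
      - sgn (τ (toℕ i) w) - - sgn (not (τ (toℕ i) w)) ∎

sumFin-zero : ∀ k (f : Fin k → ℚ) → (∀ t → f t ≡ 0ℚ) → sumFin k f ≡ 0ℚ
sumFin-zero zero f f≡0 = refl
sumFin-zero (suc k) f f≡0 =
  trans (cong₂ _+_ (f≡0 Fin.zero) (sumFin-zero k (f ∘ Fin.suc) (f≡0 ∘ Fin.suc))) (ℚₚ.+-identityˡ 0ℚ)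

sumFin-single : ∀ k (f : Fin k → ℚ) (t : Fin k) → (∀ s → s ≢ t → f s ≡ 0ℚ) → sumFin k f ≡ f t
sumFin-single (suc k) f Fin.zero others≡0 =
  trans (cong (f Fin.zero +_) (sumFin-zero k (f ∘ Fin.suc) (λ s → others≡0 (Fin.suc s) (λ ()))))
        (ℚₚ.+-identityʳ (f Fin.zero))
sumFin-single (suc k) f (Fin.suc t) others≡0 =
  trans (cong₂ _+_ (others≡0 Fin.zero (λ ()))
                   (sumFin-single k (f ∘ Fin.suc) t (λ s s≢t → others≡0 (Fin.suc s) (s≢t ∘ Finₚ.suc-injective))))
        (ℚₚ.+-identityˡ (f (Fin.suc t)))

p*q≡0⇒p≡0 : ∀ {p q} → p * q ≡ 0ℚ → q ≢ 0ℚ → p ≡ 0ℚ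
p*q≡0⇒p≡0 {p} {q} pq≡0 q≢0 = begin
  p              ≡⟨ sym (ℚₚ.*-identityʳ p) ⟩
  p * 1ℚ         ≡⟨ cong (p *_) (sym (ℚₚ.*-inverseʳ q)) ⟩
  p * (q * 1/ q) ≡⟨ sym (ℚₚ.*-assoc p q (1/ q)) ⟩
  p * q * 1/ q   ≡⟨ cong (_* 1/ q) pq≡0 ⟩
  0ℚ * 1/ q      ≡⟨ ℚₚ.*-zeroˡ (1/ q) ⟩
  0ℚ             ∎
  where
  open ≡-Reasoning
  instance
    q-nonZero : NonZero q
    q-nonZero = ≢-nonZero q≢0

-- At the edge {c t, p t} only v t and vectors centred at p t, which lie strictly lower in ρ, can
-- be nonzero; so the coefficients vanish by induction on ρ of the centre.
LinIndep-stars : ∀ {n r} (v : Fin r → EdgeVec n) (c p : Fin r → Fin n) (ρ : Fin n → ℕ) →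
  (∀ s t → c s ≡ c t → s ≡ t) →
  (∀ t → ρ (p t) Nat.< ρ (c t)) →
  (∀ t → v t (c t) (p t) ≢ 0ℚ) →
  (∀ t a b → a ≢ c t → b ≢ c t → v t a b ≡ 0ℚ) →
  LinIndep v
LinIndep-stars {n} {r} v c p ρ c-injective p-below v-at-p≢0 v-off-star λs Σλv≡0 t =
  vanish (suc (ρ (c t))) t Natₚ.≤-refl
  where
  vanish : ∀ bound t → ρ (c t) Nat.< bound → λs t ≡ 0ℚ
  vanish (suc bound) t (s≤s ρct≤bound) =
    p*q≡0⇒p≡0 (trans (sym (sumFin-single r (λ s → λs s * v s (c t) (p t)) t others≡0)) (Σλv≡0 (c t) (p t)))
              (v-at-p≢0 t)
    where
    others≡0 : ∀ s → s ≢ t → λs s * v s (c t) (p t) ≡ 0ℚ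
    others≡0 s s≢t with c s ≟ᶠ p t
    ... | yes cs≡pt = trans (cong (_* v s (c t) (p t)) (vanish bound s cs-below)) (ℚₚ.*-zeroˡ (v s (c t) (p t)))
      where
      cs-below : ρ (c s) Nat.< bound
      cs-below = Natₚ.<-≤-trans (subst (λ x → ρ x Nat.< ρ (c t)) (sym cs≡pt) (p-below t)) ρct≤bound
    ... | no cs≢pt =
      trans (cong (λs s *_) (v-off-star s (c t) (p t) (s≢t ∘ sym ∘ c-injective t s) (cs≢pt ∘ sym)))
            (ℚₚ.*-zeroʳ (λs s))

lookup-injective : ∀ {A B : Set} {f : A → B} {xs : List A} → AllPairs (λ x y → f x ≢ f y) xs →
  ∀ s t → f (lookup xs s) ≡ f (lookup xs t) → s ≡ t
lookup-injective (_ ∷ _) Fin.zero Fin.zero _ = refl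
lookup-injective (x≢ ∷ _) Fin.zero (Fin.suc t) fx≡ = ⊥-elim (All.lookup x≢ (∈-lookup t) fx≡)
lookup-injective (x≢ ∷ _) (Fin.suc s) Fin.zero fx≡ = ⊥-elim (All.lookup x≢ (∈-lookup s) (sym fx≡))
lookup-injective (_ ∷ distinct) (Fin.suc s) (Fin.suc t) fx≡ = cong Fin.suc (lookup-injective distinct s t fx≡)

toList-proj₁ : ∀ {A : Set} {P : A → Set} {xs : List A} (ps : All P xs) → map proj₁ (All.toList ps) ≡ xs
toList-proj₁ [] = refl
toList-proj₁ (p ∷ ps) = cong (_ ∷_) (toList-proj₁ ps)

length-filter+filter-¬ : ∀ {A : Set} {P : A → Set} (P? : Decidable P) (xs : List A) →
  length (filter P? xs) Nat.+ length (filter (¬? ∘ P?) xs) ≡ length xs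
length-filter+filter-¬ P? [] = refl
length-filter+filter-¬ P? (x ∷ xs) with P? x
... | yes _ = cong suc (length-filter+filter-¬ P? xs)
... | no _ = trans (Natₚ.+-suc _ _) (cong suc (length-filter+filter-¬ P? xs))

larger-half : ∀ (P : ℕ → Set) a b → P a → P b → ∃ λ r → P r × a Nat.+ b Nat.≤ r Nat.+ r
larger-half P a b Pa Pb with Natₚ.≤-total a b
... | inj₁ a≤b = b , Pb , Natₚ.+-monoˡ-≤ b a≤b
... | inj₂ b≤a = a , Pa , Natₚ.+-monoʳ-≤ a b≤a

ℕtoℚ-mkℚ : ∀ k → ℕtoℚ k ≡ mkℚ (ℤ.+ k) 0 (Coprime.sym (Coprime.1-coprimeTo k))
ℕtoℚ-mkℚ k = ℚₚ.normalize-coprime (Coprime.sym (Coprime.1-coprimeTo k))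

½*m≤r : ∀ {m r} → m Nat.≤ r Nat.+ r → ½ * ℕtoℚ m ≤ ℕtoℚ r
½*m≤r {m} {r} m≤r+r rewrite ℕtoℚ-mkℚ m | ℕtoℚ-mkℚ r = ℚₚ.toℚᵘ-cancel-≤
  (ℚᵘ.≤-respˡ-≃ (ℚᵘ.≃-sym (ℚₚ.toℚᵘ-homo-* ½ (mkℚ (ℤ.+ m) 0 (Coprime.sym (Coprime.1-coprimeTo m)))))
    (ℚᵘ.*≤* (subst₂ ℤ._≤_ (sym 1*m*1≡m) (ℤₚ.pos-* r 2) (ℤ.+≤+ m≤r*2))))
  where
  1*m*1≡m : (ℤ.+ 1 ℤ.* ℤ.+ m) ℤ.* ℤ.+ 1 ≡ ℤ.+ m
  1*m*1≡m = trans (ℤₚ.*-identityʳ _) (ℤₚ.*-identityˡ _)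
  m≤r*2 : m Nat.≤ r Nat.* 2
  m≤r*2 = subst (m Nat.≤_) (trans (cong (r Nat.+_) (sym (Natₚ.+-identityʳ r))) (Natₚ.*-comm 2 r)) m≤r+r

module _ {n : ℕ} (τ₀ : Config n) (W : MoveSeq n) where

  Star : Set
  Star = ∃ (StarArc τ₀ W)

  partnerOf : Star → Fin n
  partnerOf (_ , σ) = StarArc.partner σ

  rank-stars : (S : List Star) → AllPairs (λ x y → proj₁ x ≢ proj₁ y) S → (ρ : Fin n → ℕ) →
    All (λ x → ρ (partnerOf x) Nat.< ρ (proj₁ x)) S → RankArcsAtLeast τ₀ W (length S)
  rank-stars S distinct ρ below =
    (λ t → StarArc.arc (proj₂ (lookup S t))) ,
    LinIndep-stars (λ t → arcVec τ₀ W (StarArc.arc (proj₂ (lookup S t))))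
      (λ t → proj₁ (lookup S t)) (λ t → partnerOf (lookup S t)) ρ
      (lookup-injective distinct) (λ t → All.lookup below (∈-lookup t))
      (λ t → StarArc.arcVec-partner≢0 (proj₂ (lookup S t)))
      (λ t → StarArc.arcVec-off-star (proj₂ (lookup S t)))

  V2? : (u : Fin n) → Dec (2 Nat.≤ countOne u W)
  V2? u = 2 Nat.≤? countOne u W

  module _ (valid : Valid W) where

    star : ∀ {u} → 2 Nat.≤ countOne u W → StarArc τ₀ W u
    star {u} u∈V2 with firstArc u W u∈V2
    ... | α , refl = Arc⇒StarArc τ₀ W valid α

    stars : List Star
    stars = All.toList (All.map star (all-filter V2? (allFin n)))

    stars-centres : map proj₁ stars ≡ filter V2? (allFin n)
    stars-centres = toList-proj₁ (All.map star (all-filter V2? (allFin n)))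

    stars-distinct : AllPairs (λ x y → proj₁ x ≢ proj₁ y) stars
    stars-distinct = AllPairs.map⁻ (subst Unique (sym stars-centres) (Unique-filter⁺ V2? (allFin⁺ n)))

    length-stars : length stars ≡ V2size W
    length-stars = trans (sym (length-map proj₁ stars)) (cong length stars-centres)

    ascending? : Decidable (λ x → toℕ (proj₁ x) Nat.< toℕ (partnerOf x))
    ascending? x = toℕ (proj₁ x) Nat.<? toℕ (partnerOf x)

    rank-ascending : RankArcsAtLeast τ₀ W (length (filter ascending? stars))
    rank-ascending = rank-stars _ (AllPairs.filter⁺ ascending? stars-distinct) (λ u → n Nat.∸ toℕ u)
      (All.map (λ {x} c<p → Natₚ.∸-monoʳ-< c<p (Finₚ.toℕ≤n (partnerOf x))) (all-filter ascending? stars))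

    rank-descending : RankArcsAtLeast τ₀ W (length (filter (¬? ∘ ascending?) stars))
    rank-descending = rank-stars _ (AllPairs.filter⁺ (¬? ∘ ascending?) stars-distinct) toℕ
      (All.map (λ {x} c≮p → Natₚ.≤∧≢⇒< (Natₚ.≮⇒≥ c≮p) (StarArc.partner≢centre (proj₂ x) ∘ Finₚ.toℕ-injective))
               (all-filter (¬? ∘ ascending?) stars))

    rank-half : ∃ λ r → RankArcsAtLeast τ₀ W r × V2size W Nat.≤ r Nat.+ r
    rank-half with larger-half (RankArcsAtLeast τ₀ W) _ _ rank-ascending rank-descending
    ... | r , rank , bound = r , rank ,
      subst (Nat._≤ r Nat.+ r) (trans (length-filter+filter-¬ ascending? stars) length-stars) bound

lemma6p2 : Σ ℚ λ c → (0ℚ < c) ×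
    ((n : ℕ) (W : MoveSeq n) (τ₀ : Config n) → Valid W →
      ∃ λ (r : ℕ) → RankArcsAtLeast τ₀ W r × (c * ℕtoℚ (V2size W) ≤ ℕtoℚ r))
lemma6p2 = ½ , ℚₚ.positive⁻¹ ½ , λ n W τ₀ valid →
  let r , rank , V2≤r+r = rank-half τ₀ W valid in r , rank , ½*m≤r {V2size W} {r} V2≤r+r
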